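{- Let $s$ be a Lucasian GNS over a ring $D$, and let $\mathcal F\subset\mathbf N$ be stable under division. To verify that $s$ is $\mathcal F$-Green, it suffices to check the defining congruence in the case $m=\ell=\operatorname{lcm}(a,b)$; that is, if $s(\ell)\equiv\frac{s(a)s(b)}{s(g)}\bmod s(a)s(b)$ for all $a,b$ with $\operatorname{lcm}(a,b)\in\mathcal F$ (where $g=\gcd(a,b)$), then $s$ is $\mathcal F$-Green.
   Context: A GNS over $D$ is a function $s\colon\mathbf N\to D$ with $s(0)=0$, $s(n)$ a non-zero-divisor for $n>0$, and $s(n-k)\mid s(n)-s(k)$ for $n>k>0$. It is Lucasian if $s(a+b)\equiv s(a)+s(b)\bmod s(a)s(b)$. For $\mathcal F\subset\mathbf N$ stable under division, $s$ is $\mathcal F$-Green if for all $m\in\mathcal F$ and all positive $a,b\mid m$, with $g=\gcd(a,b)$ and $\ell=\operatorname{lcm}(a,b)$, one has $s(m)\equiv\frac m\ell\,\frac{s(a)s(b)}{s(g)}\bmod s(a)s(b)$. -}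

module Defs where

open import Level using (_⊔_)
open import Algebra.Bundles using (CommutativeRing)
import Algebra.Definitions.RawMonoid as RawMonoidDefs
open import Data.Nat as ℕ using (ℕ; zero; suc; NonZero; _<_)
open import Data.Nat.Properties using (*-zeroʳ)
open import Data.Nat.GCD using (gcd)
open import Data.Nat.LCM using (lcm; gcd*lcm)
open import Data.Nat.DivMod using (_/_)
open import Data.Product using (Σ; _,_)
open import Data.Empty using (⊥)
open import Data.Nat.Divisibility as ℕD using ()
open import Relation.Binary.PropositionalEquality using (_≡_; sym; trans; cong)

lcm-nonZero : ∀ a b → .{{NonZero a}} → .{{NonZero b}} → NonZero (lcm a b)
lcm-nonZero (suc a) (suc b) = ℕ.≢-nonZero λ eq →
  help {a} {b} (trans (sym (gcd*lcm (suc a) (suc b))) (trans (cong (gcd (suc a) (suc b) ℕ.*_) eq) (*-zeroʳ (gcd (suc a) (suc b)))))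
  where
  help : ∀ {x y} → suc x ℕ.* suc y ≡ 0 → ⊥
  help ()

_/lcm[_,_] : (m a b : ℕ) → .{{NonZero a}} → .{{NonZero b}} → ℕ
(m /lcm[ a , b ]) = _/_ m (lcm a b) {{lcm-nonZero a b}}

module _ {c ℓ} (R : CommutativeRing c ℓ) where
  open CommutativeRing R
  open RawMonoidDefs +-rawMonoid using (_×_)

  _∣R_ : Carrier → Carrier → Set (c ⊔ ℓ)
  x ∣R y = Σ Carrier λ z → y ≈ x * z

  _≡_[mod_] : Carrier → Carrier → Carrier → Set (c ⊔ ℓ)
  x ≡ y [mod n ] = n ∣R (x - y)

  -- non-zero-divisor (commutative ring: one side suffices)
  NonZeroDivisor : Carrier → Set (c ⊔ ℓ)
  NonZeroDivisor x = ∀ y → x * y ≈ 0# → y ≈ 0#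

  record IsGNS (s : ℕ → Carrier) : Set (c ⊔ ℓ) where
    field
      s0    : s 0 ≈ 0#
      nzd   : ∀ n → 0 < n → NonZeroDivisor (s n)
      diff  : ∀ n k → 0 < k → k < n → s (n ℕ.∸ k) ∣R (s n - s k)

  IsLucasian : (ℕ → Carrier) → Set (c ⊔ ℓ)
  IsLucasian s = ∀ a b → s (a ℕ.+ b) ≡ s a + s b [mod s a * s b ]

  DivisionStable : (ℕ → Set) → Set
  DivisionStable 𝓕 = ∀ m d → d ℕD.∣ m → 𝓕 m → 𝓕 d

  -- 𝓕-Green.  The quotient s(a)s(b)/s(g) (well defined since s(g) is a
  -- non-zero-divisor) is expressed as any q with s(g) * q ≈ s(a) * s(b).
  IsGreen : (ℕ → Set) → (ℕ → Carrier) → Set (c ⊔ ℓ)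
  IsGreen 𝓕 s = ∀ m → 𝓕 m → ∀ a b → .{{_ : NonZero a}} → .{{_ : NonZero b}} →
    a ℕD.∣ m → b ℕD.∣ m →
    ∀ q → s (gcd a b) * q ≈ s a * s b →
    s m ≡ (m /lcm[ a , b ]) × q [mod s a * s b ]

  IsGreenAtLcm : (ℕ → Set) → (ℕ → Carrier) → Set (c ⊔ ℓ)
  IsGreenAtLcm 𝓕 s = ∀ a b → .{{_ : NonZero a}} → .{{_ : NonZero b}} →
    𝓕 (lcm a b) →
    ∀ q → s (gcd a b) * q ≈ s a * s b →
    s (lcm a b) ≡ q [mod s a * s b ]

-- A GNS is a divisibility sequence: d ∣ n ⇒ s(d) ∣ s(n).  So for a, b ∣ L the modulus
-- s(a)s(b) divides s(L)s(jL), and the Lucasian congruence s((j+1)L) ≡ s(L) + s(jL) gives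
-- s(jL) ≡ j·s(L) mod s(a)s(b) by induction on j.  Writing m = jL with L = lcm(a, b)
-- reduces the Green congruence at m to the one at L.
module Submission where

open import Defs
open import Level using (_⊔_)
open import Algebra.Bundles using (CommutativeRing)
import Algebra.Definitions.RawMonoid as RawMonoidDefs
open import Algebra.Solver.Ring.AlmostCommutativeRing using (fromCommutativeRing; -raw-almostCommutative⟶)
import Algebra.Solver.Ring as RingSolver
open import Data.Nat as ℕ using (ℕ; zero; suc; _<_; z<s; >-nonZero⁻¹)
import Data.Nat.Properties as ℕₚ
open import Data.Nat.Divisibility as ℕD using (divides; n∣m*n)
open import Data.Nat.LCM using (lcm; lcm-least; m∣lcm[m,n]; n∣lcm[m,n])
open import Data.Nat.DivMod using (m/n*n≡m)
open import Data.Maybe using (nothing)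
open import Data.Product using (_,_)
import Relation.Binary.PropositionalEquality as ≡

module Congruence {c ℓ} (R : CommutativeRing c ℓ) where
  open CommutativeRing R
  open RawMonoidDefs +-rawMonoid using (_×_)
  open RingSolver _ (fromCommutativeRing R) (-raw-almostCommutative⟶ (fromCommutativeRing R)) (λ _ _ → nothing)
    using (solve; _:+_; _:*_; _:-_; _:=_)
  open import Algebra.Properties.Group +-group using (//-rightDividesˡ)

  infix 4 _∣_ _≈_[mod_]

  _∣_ : Carrier → Carrier → Set (c ⊔ ℓ)
  _∣_ = _∣R_ R

  _≈_[mod_] : Carrier → Carrier → Carrier → Set (c ⊔ ℓ)
  x ≈ y [mod n ] = _≡_[mod_] R x y n

  ∣-respʳ : ∀ {x y y′} → y ≈ y′ → x ∣ y → x ∣ y′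
  ∣-respʳ y≈y′ (z , y≈xz) = z , trans (sym y≈y′) y≈xz

  ∣-refl : ∀ {x} → x ∣ x
  ∣-refl {x} = 1# , sym (*-identityʳ x)

  ∣-trans : ∀ {x y z} → x ∣ y → y ∣ z → x ∣ z
  ∣-trans {x} (u , y≈xu) (v , z≈yv) = u * v , trans z≈yv (trans (*-congʳ y≈xu) (*-assoc x u v))

  ∣-zero : ∀ {x y} → y ≈ 0# → x ∣ y
  ∣-zero {x} y≈0 = 0# , trans y≈0 (sym (zeroʳ x))

  ∣-+ : ∀ {x y z} → x ∣ y → x ∣ z → x ∣ y + z
  ∣-+ {x} (u , y≈xu) (v , z≈xv) = u + v , trans (+-cong y≈xu z≈xv) (sym (distribˡ x u v))

  *-cong-∣ : ∀ {x y x′ y′} → x ∣ y → x′ ∣ y′ → x * x′ ∣ y * y′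
  *-cong-∣ {x} {_} {x′} (u , y≈xu) (v , y′≈x′v) = u * v , trans (*-cong y≈xu y′≈x′v)
    (solve 4 (λ x u x′ v → (x :* u) :* (x′ :* v) := (x :* x′) :* (u :* v)) refl x u x′ v)

  ≈⇒≈-mod : ∀ {n x y} → x ≈ y → x ≈ y [mod n ]
  ≈⇒≈-mod {_} {x} {y} x≈y = ∣-zero (trans (+-congʳ x≈y) (-‿inverseʳ y))

  ≈-mod-trans : ∀ {n x y z} → x ≈ y [mod n ] → y ≈ z [mod n ] → x ≈ z [mod n ]
  ≈-mod-trans {_} {x} {y} {z} x≡y y≡z = ∣-respʳ telescope (∣-+ x≡y y≡z)
    where
    telescope : (x - y) + (y - z) ≈ x - z
    telescope = trans (sym (+-assoc (x - y) y (- z))) (+-congʳ (//-rightDividesˡ y x))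

  +-cong-mod : ∀ {n x y x′ y′} → x ≈ y [mod n ] → x′ ≈ y′ [mod n ] → x + x′ ≈ y + y′ [mod n ]
  +-cong-mod {_} {x} {y} {x′} {y′} x≡y x′≡y′ = ∣-respʳ regroup (∣-+ x≡y x′≡y′)
    where
    regroup : (x - y) + (x′ - y′) ≈ (x + x′) - (y + y′)
    regroup = solve 4 (λ x y x′ y′ → (x :- y) :+ (x′ :- y′) := (x :+ x′) :- (y :+ y′)) refl x y x′ y′

  ×-cong-mod : ∀ {n x y} j → x ≈ y [mod n ] → j × x ≈ j × y [mod n ]
  ×-cong-mod zero    x≡y = ≈⇒≈-mod refl
  ×-cong-mod (suc j) x≡y = +-cong-mod x≡y (×-cong-mod j x≡y)

module GNS {c ℓ} (R : CommutativeRing c ℓ) (s : ℕ → CommutativeRing.Carrier R) where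
  open CommutativeRing R
  open RawMonoidDefs +-rawMonoid using (_×_)
  open Congruence R
  open import Algebra.Properties.Group +-group using (//-rightDividesˡ)

  module _ (gns : IsGNS R s) where
    open IsGNS gns

    s∣s[+] : ∀ {a} k → 0 < a → s a ∣ s k → s a ∣ s (a ℕ.+ k)
    s∣s[+] {a} zero    _   _      = ≡.subst (λ n → s a ∣ s n) (≡.sym (ℕₚ.+-identityʳ a)) ∣-refl
    s∣s[+] {a} (suc k) a>0 sa∣sk = ∣-respʳ (//-rightDividesˡ (s (suc k)) (s n)) (∣-+ sa∣diff sa∣sk)
      where
      n = a ℕ.+ suc k
      sa∣diff : s a ∣ s n - s (suc k)
      sa∣diff = ≡.subst (λ d → s d ∣ s n - s (suc k)) (ℕₚ.m+n∸n≡m a (suc k))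
        (diff n (suc k) z<s (ℕₚ.m<n+m (suc k) a>0))

    s∣s[*] : ∀ {a} j → 0 < a → s a ∣ s (j ℕ.* a)
    s∣s[*] zero    _   = ∣-zero s0
    s∣s[*] (suc j) a>0 = s∣s[+] (j ℕ.* _) a>0 (s∣s[*] j a>0)

    ∣⇒s∣s : ∀ {a n} → 0 < a → a ℕD.∣ n → s a ∣ s n
    ∣⇒s∣s a>0 (divides j ≡.refl) = s∣s[*] j a>0

    module _ (lucasian : IsLucasian R s) where

      s[j*L]≈j×s[L] : ∀ {n} L → (∀ j → n ∣ s L * s (j ℕ.* L)) → ∀ j → s (j ℕ.* L) ≈ j × s L [mod n ]
      s[j*L]≈j×s[L] L n∣ zero    = ≈⇒≈-mod s0
      s[j*L]≈j×s[L] L n∣ (suc j) =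
        ≈-mod-trans (∣-trans (n∣ j) (lucasian L (j ℕ.* L))) (+-cong-mod (≈⇒≈-mod refl) (s[j*L]≈j×s[L] L n∣ j))

      s[j*L]≈j×s[L]-mod-s[a]*s[b] : ∀ {a b L} → 0 < a → 0 < b → a ℕD.∣ L → b ℕD.∣ L →
        ∀ j → s (j ℕ.* L) ≈ j × s L [mod s a * s b ]
      s[j*L]≈j×s[L]-mod-s[a]*s[b] {L = L} a>0 b>0 a∣L b∣L = s[j*L]≈j×s[L] L λ j →
        ∣-respʳ (*-comm _ _) (*-cong-∣ (∣⇒s∣s a>0 (ℕD.∣-trans a∣L (n∣m*n j))) (∣⇒s∣s b>0 b∣L))

mainTheorem9 : ∀ {c ℓ} (R : CommutativeRing c ℓ) (s : ℕ → CommutativeRing.Carrier R) (𝓕 : ℕ → Set) →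
    IsGNS R s → IsLucasian R s → DivisionStable R 𝓕 →
    IsGreenAtLcm R 𝓕 s → IsGreen R 𝓕 s
mainTheorem9 R s 𝓕 gns lucasian stable greenAtLcm m 𝓕m a b a∣m b∣m q s[g]q≈s[a]s[b] =
  ≡.subst (λ n → s n ≈ j × q [mod s a * s b ]) (m/n*n≡m ⦃ lcm-nonZero a b ⦄ L∣m)
    (≈-mod-trans
      (s[j*L]≈j×s[L]-mod-s[a]*s[b] gns lucasian (>-nonZero⁻¹ a) (>-nonZero⁻¹ b) (m∣lcm[m,n] a b) (n∣lcm[m,n] a b) j)
      (×-cong-mod j (greenAtLcm a b (stable m L L∣m 𝓕m) q s[g]q≈s[a]s[b])))
  where
  open CommutativeRing R using (_*_)
  open RawMonoidDefs (CommutativeRing.+-rawMonoid R) using (_×_)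
  open Congruence R
  open GNS R s
  L = lcm a b
  L∣m = lcm-least a∣m b∣m
  j = m /lcm[ a , b ]
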